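{- Let $P$ be a predicate of Gödel's system $\mathcal{T}$ of arity $k+1$, and let $E_P:=\lambda\vec\alpha^{\mathbb{N}}\,\langle\mathsf{X}_P\vec\alpha,\ \langle\Phi_P\vec\alpha,\varnothing\rangle,\ \lambda n^{\mathbb{N}}\,\mathsf{Add}_P\vec\alpha n\rangle$. Then $E_P\Vvdash\forall\vec x.\ \exists y\,P(\vec x,y)\vee\forall y\,\neg_{\mathsf{Bool}}P(\vec x,y)$.
   Context: Gödel's system $\mathcal{T}$: simply typed $\lambda$-calculus with atomic types $\mathbb{N},\mathsf{Bool}$, products, arrows, $0,\mathsf{S},\mathsf{True},\mathsf{False}$, conditionals, recursors, pairing and projections; numerals are $\mathsf{S}^n(0)$; $\neg_{\mathsf{Bool}}$ is a term of $\mathcal{T}$ implementing boolean negation, and $\neg_{\mathsf{Bool}}P(\vec x,y)$ is the atomic formula $Q\vec xy$ with $Q=\lambda\vec x\lambda y.\neg_{\mathsf{Bool}}(P\vec xy)$. $\langle u_0,u_1,u_2\rangle:=\langle u_0,\langle u_1,u_2\rangle\rangle$, with projections $p_0=\pi_0,p_1=\lambda x.\pi_0(\pi_1x),p_2=\lambda x.\pi_1(\pi_1x)$. A $k$-ary predicate of $\mathcal{T}$ is a closed normal term $\mathbb{N}^k\to\mathsf{Bool}$. An atom is $\langle P,\vec n,m\rangle$ with $P\vec nm=\mathsf{True}$; atoms $\langle P,\vec n,m\rangle,\langle P',\vec n',m'\rangle$ are consistent if $P=P',\vec n=\vec n'$ imply $m=m'$; a state is a finite set of pairwise consistent atoms;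 $S_1\uplus S_2$ is $S_1\cup S_2$ minus the atoms of $S_2$ inconsistent with an atom of $S_1$. $\mathcal{T}_{\mathrm{State}}$ adds to $\mathcal{T}$ an atomic type $\mathsf{State}$ and a constant $s$ for each state $|s|$ ($\varnothing$ denotes $\emptyset$). For each predicate $P$ of arity $k+1$: constants $\mathsf{X}_P:\mathbb{N}^k\to\mathsf{Bool}$, $\Phi_P:\mathbb{N}^k\to\mathbb{N}$, $\mathsf{Add}_P:\mathbb{N}^{k+1}\to\mathsf{State}$ (no reduction rules) and $\chi_P,\varphi_P,\mathsf{add}_P$ taking an extra first argument of type $\mathsf{State}$; also $\sqcup:\mathsf{State}\to\mathsf{State}\to\mathsf{State}$. $\mathcal{T}_{\mathrm{Class}}$ contains $\mathsf{X}_P,\Phi_P,\mathsf{Add}_P,\sqcup$; $\mathcal{T}_{\mathrm{Learn}}$ contains $\chi_P,\varphi_P,\mathsf{add}_P,\sqcup$ with reductions: $\chi_Ps\vec n\mapsto\mathsf{True}$ if some $\langle P,\vec n,m\rangle\in|s|$, else $\mathsf{False}$; $\varphi_Ps\vec n\mapsto m$ if $\langle P,\vec n,m\rangle\in|s|$, else $0$; $\mathsf{add}_Ps\vec nm\mapsto\varnothing$ if some $\langle P,\vec n,l\rangle\in|s|$ or $P\vec nm=\mathsf{False}$, else the constant for $\{\langle P,\vec n,m\rangle\}$; $s_1\sqcup s_2\mapsto$ the constant for $|s_1|\uplus|s_2|$. $t[s]$ replaces $\mathsf{X}_P,\Phi_P,\mathsf{Add}_P$ by $\chi_Ps,\varphi_Ps,\mathsf{add}_Ps$.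 Realizer types: $|P(\vec t)|=\mathsf{State}$, $|A\wedge B|=|A|\times|B|$, $|A\vee B|=\mathsf{Bool}\times(|A|\times|B|)$, $|A\to B|=|A|\to|B|$, $|\forall xA|=\mathbb{N}\to|A|$, $|\exists xA|=\mathbb{N}\times|A|$. For a state constant $s$, closed $t\in\mathcal{T}_{\mathrm{Class}}$ without state constants other than $\varnothing$, and closed formula $C$ (atomic formulas being closed boolean terms of $\mathcal{T}_{\mathrm{Class}}$): $t\Vvdash_sP(\vec t)$ iff $t[s]=\varnothing$ implies $P(\vec t)[s]=\mathsf{True}$ in $\mathcal{T}_{\mathrm{Learn}}$; $t\Vvdash_sA\wedge B$ iff $\pi_0t\Vvdash_sA$ and $\pi_1t\Vvdash_sB$; $t\Vvdash_sA\vee B$ iff either $p_0t[s]=\mathsf{True}$ and $p_1t\Vvdash_sA$, or $p_0t[s]=\mathsf{False}$ and $p_2t\Vvdash_sB$; $t\Vvdash_sA\to B$ iff $u\Vvdash_sA$ implies $tu\Vvdash_sB$ for all $u$; $t\Vvdash_s\forall xA$ iff $tn\Vvdash_sA[n/x]$ for all numerals $n$; $t\Vvdash_s\exists xA$ iff $\pi_0t[s]=n$ and $\pi_1t\Vvdash_sA[n/x]$ for some numeral $n$. $t\Vvdash A$ iff $t\Vvdash_sA$ for every state constant $s$. -}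

module Defs where

open import Data.Bool using (Bool; true; false)
open import Data.Nat using (ℕ; zero; suc)
open import Data.Empty using (⊥)
open import Data.Unit using (⊤; tt)
open import Data.Product using (Σ; _×_; _,_)
open import Data.Sum using (_⊎_)
open import Data.List using (List; []; _∷_)
open import Data.Vec using (Vec; []; _∷_)
import Data.Vec as Vec
open import Data.List.Membership.Propositional using (_∈_)
open import Data.List.Relation.Unary.AllPairs using (AllPairs; []; _∷_)
open import Data.List.Relation.Unary.All using ([])
open import Relation.Nullary using (¬_)
open import Relation.Binary.PropositionalEquality using (_≡_)
open import Relation.Binary.Construct.Closure.Equivalence using (EqClosure)

-- Types of T_State (T itself = the State-free fragment)

infixr 7 _⇒_
infixr 8 _⊗_

data Ty : Set where
  nat bool state : Ty
  _⊗_ _⇒_ : Ty → Ty → Ty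

StateFree : Ty → Set
StateFree nat = ⊤
StateFree bool = ⊤
StateFree state = ⊥
StateFree (A ⊗ B) = StateFree A × StateFree B
StateFree (A ⇒ B) = StateFree A × StateFree B

-- flag false: Gödel's T (only State-free types allowed);
-- flag true : T_State (all types allowed)
Ok : Bool → Ty → Set
Ok true _ = ⊤
Ok false A = StateFree A

okNat : ∀ b → Ok b nat
okNat true = tt
okNat false = tt

Ctx : Set
Ctx = List Ty

data _∋_ : Ctx → Ty → Set where
  here  : ∀ {Γ A} → (A ∷ Γ) ∋ A
  there : ∀ {Γ A B} → Γ ∋ A → (B ∷ Γ) ∋ A

data TConst (b : Bool) : Ty → Set where
  zeroC  : TConst b nat
  sucC   : TConst b (nat ⇒ nat)
  trueC  : TConst b bool
  falseC : TConst b bool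
  ifC    : ∀ {A} → .(Ok b A) → TConst b (bool ⇒ A ⇒ A ⇒ A)
  recC   : ∀ {A} → .(Ok b A) → TConst b (A ⇒ (nat ⇒ A ⇒ A) ⇒ nat ⇒ A)
  pairC  : ∀ {A B} → .(Ok b A) → .(Ok b B) → TConst b (A ⇒ B ⇒ A ⊗ B)
  fstC   : ∀ {A B} → .(Ok b A) → .(Ok b B) → TConst b (A ⊗ B ⇒ A)
  sndC   : ∀ {A B} → .(Ok b A) → .(Ok b B) → TConst b (A ⊗ B ⇒ B)

-- intrinsically typed terms, de Bruijn variables; C = extra constants
data Tm (b : Bool) (C : Ty → Set) (Γ : Ctx) : Ty → Set where
  var : ∀ {A} → Γ ∋ A → Tm b C Γ A
  lam : ∀ {A B} → .(Ok b A) → Tm b C (A ∷ Γ) B → Tm b C Γ (A ⇒ B)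
  app : ∀ {A B} → Tm b C Γ (A ⇒ B) → Tm b C Γ A → Tm b C Γ B
  tc  : ∀ {A} → TConst b A → Tm b C Γ A
  con : ∀ {A} → C A → Tm b C Γ A

module _ {b : Bool} {C : Ty → Set} where

  Ren : Ctx → Ctx → Set
  Ren Γ Δ = ∀ {A} → Γ ∋ A → Δ ∋ A

  extR : ∀ {Γ Δ B} → Ren Γ Δ → Ren (B ∷ Γ) (B ∷ Δ)
  extR ρ here = here
  extR ρ (there x) = there (ρ x)

  ren : ∀ {Γ Δ A} → Ren Γ Δ → Tm b C Γ A → Tm b C Δ A
  ren ρ (var x) = var (ρ x)
  ren ρ (lam ok t) = lam ok (ren (extR ρ) t)
  ren ρ (app t u) = app (ren ρ t) (ren ρ u)
  ren ρ (tc c) = tc c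
  ren ρ (con c) = con c

  Sub : Ctx → Ctx → Set
  Sub Γ Δ = ∀ {A} → Γ ∋ A → Tm b C Δ A

  extS : ∀ {Γ Δ B} → Sub Γ Δ → Sub (B ∷ Γ) (B ∷ Δ)
  extS σ here = var here
  extS σ (there x) = ren there (σ x)

  sub : ∀ {Γ Δ A} → Sub Γ Δ → Tm b C Γ A → Tm b C Δ A
  sub σ (var x) = σ x
  sub σ (lam ok t) = lam ok (sub (extS σ) t)
  sub σ (app t u) = app (sub σ t) (sub σ u)
  sub σ (tc c) = tc c
  sub σ (con c) = con c

  consS : ∀ {Γ Δ B} → Tm b C Δ B → Sub Γ Δ → Sub (B ∷ Γ) Δ
  consS u σ here = u
  consS u σ (there x) = σ x

  _[_] : ∀ {Γ A B} → Tm b C (B ∷ Γ) A → Tm b C Γ B → Tm b C Γ A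
  t [ u ] = sub (consS u var) t

  wk0 : ∀ {Γ A} → Tm b C [] A → Tm b C Γ A
  wk0 = ren (λ ())

  num : ∀ {Γ} → ℕ → Tm b C Γ nat
  num zero = tc zeroC
  num (suc n) = app (tc sucC) (num n)

  module _ (δ : ∀ {Γ A} → Tm b C Γ A → Tm b C Γ A → Set) where
    data Step : ∀ {Γ A} → Tm b C Γ A → Tm b C Γ A → Set where
      β    : ∀ {Γ A B} .{ok : Ok b A} (t : Tm b C (A ∷ Γ) B) (u : Tm b C Γ A) →
             Step (app (lam ok t) u) (t [ u ])
      ifT  : ∀ {Γ A} .{ok : Ok b A} (x y : Tm b C Γ A) →
             Step (app (app (app (tc (ifC ok)) (tc trueC)) x) y) x
      ifF  : ∀ {Γ A} .{ok : Ok b A} (x y : Tm b C Γ A) →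
             Step (app (app (app (tc (ifC ok)) (tc falseC)) x) y) y
      recZ : ∀ {Γ A} .{ok : Ok b A} (x : Tm b C Γ A) (f : Tm b C Γ (nat ⇒ A ⇒ A)) →
             Step (app (app (app (tc (recC ok)) x) f) (tc zeroC)) x
      recS : ∀ {Γ A} .{ok : Ok b A} (x : Tm b C Γ A) (f : Tm b C Γ (nat ⇒ A ⇒ A)) (n : Tm b C Γ nat) →
             Step (app (app (app (tc (recC ok)) x) f) (app (tc sucC) n))
                  (app (app f n) (app (app (app (tc (recC ok)) x) f) n))
      fstR : ∀ {Γ A B} .{oa oa' : Ok b A} .{ob ob' : Ok b B} (x : Tm b C Γ A) (y : Tm b C Γ B) →
             Step (app (tc (fstC oa ob)) (app (app (tc (pairC oa' ob')) x) y)) x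
      sndR : ∀ {Γ A B} .{oa oa' : Ok b A} .{ob ob' : Ok b B} (x : Tm b C Γ A) (y : Tm b C Γ B) →
             Step (app (tc (sndC oa ob)) (app (app (tc (pairC oa' ob')) x) y)) y
      delta : ∀ {Γ A} {t u : Tm b C Γ A} → δ t u → Step t u
      ξlam  : ∀ {Γ A B} .{ok : Ok b A} {t t' : Tm b C (A ∷ Γ) B} → Step t t' → Step (lam ok t) (lam ok t')
      ξappL : ∀ {Γ A B} {t t' : Tm b C Γ (A ⇒ B)} {u : Tm b C Γ A} → Step t t' → Step (app t u) (app t' u)
      ξappR : ∀ {Γ A B} {t : Tm b C Γ (A ⇒ B)} {u u' : Tm b C Γ A} → Step u u' → Step (app t u) (app t u')

    Conv : ∀ {Γ A} → Tm b C Γ A → Tm b C Γ A → Set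
    Conv {Γ} {A} = EqClosure (Step {Γ} {A})

NoC : Ty → Set
NoC _ = ⊥

TTm : Ctx → Ty → Set
TTm = Tm false NoC

noδ : ∀ {Γ A} → TTm Γ A → TTm Γ A → Set
noδ _ _ = ⊥

_⟶T_ : ∀ {Γ A} → TTm Γ A → TTm Γ A → Set
_⟶T_ = Step noδ

_≅T_ : ∀ {Γ A} → TTm Γ A → TTm Γ A → Set
_≅T_ = Conv noδ

Normal : ∀ {Γ A} → TTm Γ A → Set
Normal t = ∀ t' → ¬ (t ⟶T t')

nats : ℕ → Ty → Ty
nats zero A = A
nats (suc k) A = nats k (nat ⇒ A)

Nats : ℕ → Ctx → Ctx
Nats zero Γ = Γ
Nats (suc k) Γ = nat ∷ Nats k Γ

module _ {b : Bool} {C : Ty → Set} where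
  -- t a_1 ... a_k ; the head of the vector is the LAST argument
  appN : ∀ k {Γ A} → Tm b C Γ (nats k A) → Vec (Tm b C Γ nat) k → Tm b C Γ A
  appN zero t [] = t
  appN (suc k) t (a ∷ as) = app (appN k t as) a

  -- λx_1 ... λx_k. t  (x_k is de Bruijn index 0)
  lamN : ∀ k {Γ A} → Tm b C (Nats k Γ) A → Tm b C Γ (nats k A)
  lamN zero t = t
  lamN (suc k) t = lamN k (lam (okNat b) t)

  -- the variables x_k , ... , x_1 (head = x_k = index 0)
  vars : ∀ k {Γ} → Vec (Tm b C (Nats k Γ) nat) k
  vars zero = []
  vars (suc k) = var here ∷ Vec.map (ren there) (vars k)

  nums : ∀ {k Γ} → Vec ℕ k → Vec (Tm b C Γ nat) k
  nums = Vec.map num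

record Atom : Set where
  constructor mkAtom
  field
    k       : ℕ
    P       : TTm [] (nats (suc k) bool)
    .normal : Normal P
    ns      : Vec ℕ k
    m       : ℕ
    .holds  : appN (suc k) P (num m ∷ nums ns) ≅T tc trueC

Key : Set
Key = Σ ℕ (λ k → TTm [] (nats (suc k) bool) × Vec ℕ k)

key : Atom → Key
key a = (Atom.k a , Atom.P a , Atom.ns a)

Consistent : Atom → Atom → Set
Consistent a b = key a ≡ key b → Atom.m a ≡ Atom.m b

record State : Set where
  constructor mkState
  field
    atoms       : List Atom
    .consistent : AllPairs Consistent atoms

_∈ₛ_ : Atom → State → Set
a ∈ₛ s = a ∈ State.atoms s

emptyState : State
emptyState = mkState [] []

singleState : Atom → State
singleState a = mkState (a ∷ []) ([] ∷ [])

InUplus : State → State → Atom → Set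
InUplus s1 s2 a = a ∈ₛ s1 ⊎ (a ∈ₛ s2 × (∀ c → c ∈ₛ s1 → Consistent c a))

HasKey : State → Key → Set
HasKey s κ = Σ Atom (λ a → a ∈ₛ s × key a ≡ κ)

data ClassC : Ty → Set where
  empty : ClassC state
  X     : ∀ {k} (P : TTm [] (nats (suc k) bool)) → .(Normal P) → ClassC (nats k bool)
  Φ     : ∀ {k} (P : TTm [] (nats (suc k) bool)) → .(Normal P) → ClassC (nats k nat)
  Add   : ∀ {k} (P : TTm [] (nats (suc k) bool)) → .(Normal P) → ClassC (nats (suc k) state)
  join  : ClassC (state ⇒ state ⇒ state)

data LearnC : Ty → Set where
  st   : State → LearnC state
  χ    : ∀ {k} (P : TTm [] (nats (suc k) bool)) → .(Normal P) → LearnC (state ⇒ nats k bool)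
  φ    : ∀ {k} (P : TTm [] (nats (suc k) bool)) → .(Normal P) → LearnC (state ⇒ nats k nat)
  add  : ∀ {k} (P : TTm [] (nats (suc k) bool)) → .(Normal P) → LearnC (state ⇒ nats (suc k) state)
  join : LearnC (state ⇒ state ⇒ state)

CTm LTm : Ctx → Ty → Set
CTm = Tm true ClassC
LTm = Tm true LearnC

data δL : ∀ {Γ A} → LTm Γ A → LTm Γ A → Set where
  χ-yes : ∀ {Γ k} (P : TTm [] (nats (suc k) bool)) .(nf : Normal P) (s : State) (ns : Vec ℕ k) →
          HasKey s (k , P , ns) →
          δL {Γ} (appN k (app (con (χ {k} P nf)) (con (st s))) (nums ns)) (tc trueC)
  χ-no  : ∀ {Γ k} (P : TTm [] (nats (suc k) bool)) .(nf : Normal P) (s : State) (ns : Vec ℕ k) →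
          ¬ HasKey s (k , P , ns) →
          δL {Γ} (appN k (app (con (χ {k} P nf)) (con (st s))) (nums ns)) (tc falseC)
  φ-yes : ∀ {Γ k} (P : TTm [] (nats (suc k) bool)) .(nf : Normal P) (s : State) (ns : Vec ℕ k) →
          (a : Atom) → a ∈ₛ s → key a ≡ (k , P , ns) →
          δL {Γ} (appN k (app (con (φ {k} P nf)) (con (st s))) (nums ns)) (num (Atom.m a))
  φ-no  : ∀ {Γ k} (P : TTm [] (nats (suc k) bool)) .(nf : Normal P) (s : State) (ns : Vec ℕ k) →
          ¬ HasKey s (k , P , ns) →
          δL {Γ} (appN k (app (con (φ {k} P nf)) (con (st s))) (nums ns)) (num 0)
  add-old : ∀ {Γ k} (P : TTm [] (nats (suc k) bool)) .(nf : Normal P) (s : State) (ns : Vec ℕ k) (m : ℕ) →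
          HasKey s (k , P , ns) →
          δL {Γ} (appN (suc k) (app (con (add {k} P nf)) (con (st s))) (num m ∷ nums ns)) (con (st emptyState))
  add-false : ∀ {Γ k} (P : TTm [] (nats (suc k) bool)) .(nf : Normal P) (s : State) (ns : Vec ℕ k) (m : ℕ) →
          appN (suc k) P (num m ∷ nums ns) ≅T tc falseC →
          δL {Γ} (appN (suc k) (app (con (add {k} P nf)) (con (st s))) (num m ∷ nums ns)) (con (st emptyState))
  add-new : ∀ {Γ k} (P : TTm [] (nats (suc k) bool)) .(nf : Normal P) (s : State) (ns : Vec ℕ k) (m : ℕ) →
          ¬ HasKey s (k , P , ns) →
          (h : appN (suc k) P (num m ∷ nums ns) ≅T tc trueC) →
          δL {Γ} (appN (suc k) (app (con (add {k} P nf)) (con (st s))) (num m ∷ nums ns))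
                 (con (st (singleState (mkAtom k P nf ns m h))))
  join-r : ∀ {Γ} (s1 s2 s3 : State) →
          (∀ a → a ∈ₛ s3 → InUplus s1 s2 a) → (∀ a → InUplus s1 s2 a → a ∈ₛ s3) →
          δL {Γ} (app (app (con join) (con (st s1))) (con (st s2))) (con (st s3))

_≅L_ : ∀ {Γ A} → LTm Γ A → LTm Γ A → Set
_≅L_ = Conv δL

learn : ∀ {Γ A} → State → CTm Γ A → LTm Γ A
learn s (var x) = var x
learn s (lam ok t) = lam ok (learn s t)
learn s (app t u) = app (learn s t) (learn s u)
learn s (tc zeroC) = tc zeroC
learn s (tc sucC) = tc sucC
learn s (tc trueC) = tc trueC
learn s (tc falseC) = tc falseC
learn s (tc (ifC ok)) = tc (ifC ok)
learn s (tc (recC ok)) = tc (recC ok)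
learn s (tc (pairC o1 o2)) = tc (pairC o1 o2)
learn s (tc (fstC o1 o2)) = tc (fstC o1 o2)
learn s (tc (sndC o1 o2)) = tc (sndC o1 o2)
learn s (con empty) = con (st emptyState)
learn s (con (X {k} P nf)) = app (con (χ {k} P nf)) (con (st s))
learn s (con (Φ {k} P nf)) = app (con (φ {k} P nf)) (con (st s))
learn s (con (Add {k} P nf)) = app (con (add {k} P nf)) (con (st s))
learn s (con join) = con join

embC : ∀ {A} → TConst false A → TConst true A
embC zeroC = zeroC
embC sucC = sucC
embC trueC = trueC
embC falseC = falseC
embC (ifC _) = ifC tt
embC (recC _) = recC tt
embC (pairC _ _) = pairC tt tt
embC (fstC _ _) = fstC tt tt
embC (sndC _ _) = sndC tt tt

emb : ∀ {Γ A} → TTm Γ A → CTm Γ A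
emb (var x) = var x
emb (lam _ t) = lam tt (emb t)
emb (app t u) = app (emb t) (emb u)
emb (tc c) = tc (embC c)
emb (con ())

data Fm (Γ : Ctx) : Set where
  atomF : CTm Γ bool → Fm Γ
  _∧F_ _∨F_ _⇒F_ : Fm Γ → Fm Γ → Fm Γ
  ∀F ∃F : Fm (nat ∷ Γ) → Fm Γ

∣_∣ : ∀ {Γ} → Fm Γ → Ty
∣ atomF _ ∣ = state
∣ A ∧F B ∣ = ∣ A ∣ ⊗ ∣ B ∣
∣ A ∨F B ∣ = bool ⊗ (∣ A ∣ ⊗ ∣ B ∣)
∣ A ⇒F B ∣ = ∣ A ∣ ⇒ ∣ B ∣
∣ ∀F A ∣ = nat ⇒ ∣ A ∣
∣ ∃F A ∣ = nat ⊗ ∣ A ∣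

π₀ : ∀ {Γ A B} → CTm Γ (A ⊗ B ⇒ A)
π₀ = tc (fstC tt tt)

π₁ : ∀ {Γ A B} → CTm Γ (A ⊗ B ⇒ B)
π₁ = tc (sndC tt tt)

p₀ : ∀ {Γ A B C} → CTm Γ (A ⊗ (B ⊗ C) ⇒ A)
p₀ = π₀

p₁ : ∀ {Γ A B C} → CTm Γ (A ⊗ (B ⊗ C) ⇒ B)
p₁ = lam tt (app π₀ (app π₁ (var here)))

p₂ : ∀ {Γ A B C} → CTm Γ (A ⊗ (B ⊗ C) ⇒ C)
p₂ = lam tt (app π₁ (app π₁ (var here)))

-- Realizability t ⊩_s A, for A with its free variables closed by a
-- substitution σ of closed terms (numerals); the formula meant is A σ.
Real : ∀ {Γ} → State → (A : Fm Γ) → Sub {true} {ClassC} Γ [] → CTm [] ∣ A ∣ → Set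
Real s (atomF P) σ t = learn s t ≅L con (st emptyState) → learn s (sub σ P) ≅L tc trueC
Real s (A ∧F B) σ t = Real s A σ (app π₀ t) × Real s B σ (app π₁ t)
Real s (A ∨F B) σ t =
    (learn s (app p₀ t) ≅L tc trueC × Real s A σ (app p₁ t))
  ⊎ (learn s (app p₀ t) ≅L tc falseC × Real s B σ (app p₂ t))
Real s (A ⇒F B) σ t = ∀ u → Real s A σ u → Real s B σ (app t u)
Real s (∀F A) σ t = ∀ n → Real s A (consS (num n) σ) (app t (num n))
Real s (∃F A) σ t = Σ ℕ (λ n → (learn s (app π₀ t) ≅L num n) × Real s A (consS (num n) σ) (app π₁ t))

noVars : Sub {true} {ClassC} [] []
noVars ()

_⊩_ : (A : Fm []) → CTm [] ∣ A ∣ → Set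
A ⊩ t = ∀ (s : State) → Real s A noVars t

allN : ∀ k {Γ} → Fm (Nats k Γ) → Fm Γ
allN zero A = A
allN (suc k) A = allN k (∀F A)

lamAll : ∀ k {Γ Δ} (A : Fm (Nats k Γ)) → CTm (Nats k Δ) ∣ A ∣ → CTm Δ ∣ allN k A ∣
lamAll zero A t = t
lamAll (suc k) A t = lamAll k (∀F A) (lam tt t)

negT : ∀ {Γ} → TTm Γ (bool ⇒ bool)
negT = lam tt (app (app (app (tc (ifC tt)) (var here)) (tc falseC)) (tc trueC))

negP : ∀ {k} → TTm [] (nats (suc k) bool) → TTm [] (nats (suc k) bool)
negP {k} P = lamN (suc k) (app negT (appN (suc k) (wk0 P) (vars (suc k))))

EMbody : ∀ k → TTm [] (nats (suc k) bool) → Fm (Nats k [])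
EMbody k P =
  ∃F (atomF (appN (suc k) (wk0 (emb P)) (vars (suc k))))
  ∨F ∀F (atomF (appN (suc k) (wk0 (emb (negP {k} P))) (vars (suc k))))

EM : ∀ k → TTm [] (nats (suc k) bool) → Fm []
EM k P = allN k (EMbody k P)

pairT : ∀ {Γ A B} → CTm Γ A → CTm Γ B → CTm Γ (A ⊗ B)
pairT x y = app (app (tc (pairC tt tt)) x) y

E : ∀ k (P : TTm [] (nats (suc k) bool)) → .(Normal P) → CTm [] ∣ EM k P ∣
E k P nf = lamAll k (EMbody k P)
  (pairT (appN k (con (X {k} P nf)) (vars k))
    (pairT (pairT (appN k (con (Φ {k} P nf)) (vars k)) (con empty))
           (lam tt (appN (suc k) (con (Add {k} P nf)) (vars (suc k))))))

module Submission where

open import Defs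
open import Data.Bool using (Bool; true; false; if_then_else_)
open import Data.Nat using (ℕ; zero; suc)
import Data.Nat.Properties as ℕ
open import Data.List using ([]; _∷_)
open import Data.List.Relation.Unary.Any using (here; any?)
open import Data.List.Membership.Propositional using (find; lose)
open import Data.Unit using (⊤; tt)
import Data.Empty.Irrelevant as Irrelevant
open import Data.Product using (Σ; _×_; _,_; proj₁; proj₂)
import Data.Product.Properties as Product
open import Data.Sum using (_⊎_; inj₁; inj₂)
open import Data.Vec using (Vec; []; _∷_)
import Data.Vec as Vec
import Data.Vec.Properties as Vec
open import Relation.Nullary using (¬_; Dec; yes; no)
import Relation.Nullary.Decidable as Dec
open import Relation.Binary.PropositionalEquality hiding ([_])
open import Relation.Binary.Construct.Closure.ReflexiveTransitive using (ε; _◅_; _◅◅_)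
open import Relation.Binary.Construct.Closure.Symmetric using (fwd; bwd)
import Relation.Binary.Construct.Closure.Equivalence as EqClosure
import Relation.Binary.Reasoning.Setoid as SetoidReasoning

-- Fix a state s and numerals n⃗; in s, E_P n⃗ consults s about P(n⃗, ·).  If s contains an
-- atom ⟨P, n⃗, m⟩, then χ_P answers True, φ_P returns m, and P(n⃗, m) holds because atoms only
-- record true instances.  Otherwise χ_P answers False, and the realizer of ∀y ¬P(n⃗, y) at n is
-- add_P s n⃗ n.  If that state is ∅, either P(n⃗, n) is False and ¬P(n⃗, n) is True, or P(n⃗, n) is
-- True, in which case add_P s n⃗ n is a nonempty singleton, the hypothesis identifies it with ∅, and
-- χ_P then makes True and False interconvertible, so the atomic conclusion holds anyway.
-- What is needed about T itself: closed boolean terms convert to True or False (reducibility),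
-- True and False are not convertible (a set-theoretic model), and T-conversion persists in T_Learn.

module _ {b : Bool} {C : Ty → Set} where

  emptySub : Sub {b} {C} [] []
  emptySub ()

  ren-cong : ∀ {Γ Δ A} {ρ ρ′ : Ren {b} {C} Γ Δ} → (∀ {B} (x : Γ ∋ B) → ρ x ≡ ρ′ x) →
             (t : Tm b C Γ A) → ren ρ t ≡ ren ρ′ t
  ren-cong e (var x) = cong var (e x)
  ren-cong {ρ = ρ} {ρ′} e (lam ok t) = cong (lam ok) (ren-cong e′ t)
    where
    e′ : ∀ {B} (x : _ ∋ B) → extR {b} {C} ρ x ≡ extR ρ′ x
    e′ here = refl
    e′ (there x) = cong there (e x)
  ren-cong e (app t u) = cong₂ app (ren-cong e t) (ren-cong e u)
  ren-cong e (tc c) = refl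
  ren-cong e (con c) = refl

  ren-ren : ∀ {Γ Δ Θ A} (ρ : Ren {b} {C} Γ Δ) (ρ′ : Ren {b} {C} Δ Θ) (t : Tm b C Γ A) →
            ren ρ′ (ren ρ t) ≡ ren (λ x → ρ′ (ρ x)) t
  ren-ren ρ ρ′ (var x) = refl
  ren-ren ρ ρ′ (lam ok t) = cong (lam ok) (trans (ren-ren (extR ρ) (extR ρ′) t)
    (ren-cong (λ { here → refl ; (there x) → refl }) t))
  ren-ren ρ ρ′ (app t u) = cong₂ app (ren-ren ρ ρ′ t) (ren-ren ρ ρ′ u)
  ren-ren ρ ρ′ (tc c) = refl
  ren-ren ρ ρ′ (con c) = refl

  sub-cong : ∀ {Γ Δ A} {σ σ′ : Sub {b} {C} Γ Δ} → (∀ {B} (x : Γ ∋ B) → σ x ≡ σ′ x) →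
             (t : Tm b C Γ A) → sub σ t ≡ sub σ′ t
  sub-cong e (var x) = e x
  sub-cong {σ = σ} {σ′} e (lam ok t) = cong (lam ok) (sub-cong e′ t)
    where
    e′ : ∀ {B} (x : _ ∋ B) → extS {b} {C} σ x ≡ extS σ′ x
    e′ here = refl
    e′ (there x) = cong (ren there) (e x)
  sub-cong e (app t u) = cong₂ app (sub-cong e t) (sub-cong e u)
  sub-cong e (tc c) = refl
  sub-cong e (con c) = refl

  sub-ren : ∀ {Γ Δ Θ A} (ρ : Ren {b} {C} Γ Δ) (σ : Sub {b} {C} Δ Θ) (t : Tm b C Γ A) →
            sub σ (ren ρ t) ≡ sub (λ x → σ (ρ x)) t
  sub-ren ρ σ (var x) = refl
  sub-ren ρ σ (lam ok t) = cong (lam ok) (trans (sub-ren (extR ρ) (extS σ) t)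
    (sub-cong (λ { here → refl ; (there x) → refl }) t))
  sub-ren ρ σ (app t u) = cong₂ app (sub-ren ρ σ t) (sub-ren ρ σ u)
  sub-ren ρ σ (tc c) = refl
  sub-ren ρ σ (con c) = refl

  ren-sub : ∀ {Γ Δ Θ A} (σ : Sub {b} {C} Γ Δ) (ρ : Ren {b} {C} Δ Θ) (t : Tm b C Γ A) →
            ren ρ (sub σ t) ≡ sub (λ x → ren ρ (σ x)) t
  ren-sub σ ρ (var x) = refl
  ren-sub σ ρ (lam ok t) = cong (lam ok) (trans (ren-sub (extS σ) (extR ρ) t)
    (sub-cong (λ { here → refl
                 ; (there x) → trans (ren-ren there (extR ρ) (σ x)) (sym (ren-ren ρ there (σ x))) }) t))
  ren-sub σ ρ (app t u) = cong₂ app (ren-sub σ ρ t) (ren-sub σ ρ u)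
  ren-sub σ ρ (tc c) = refl
  ren-sub σ ρ (con c) = refl

  sub-sub : ∀ {Γ Δ Θ A} (σ : Sub {b} {C} Γ Δ) (τ : Sub {b} {C} Δ Θ) (t : Tm b C Γ A) →
            sub τ (sub σ t) ≡ sub (λ x → sub τ (σ x)) t
  sub-sub σ τ (var x) = refl
  sub-sub σ τ (lam ok t) = cong (lam ok) (trans (sub-sub (extS σ) (extS τ) t)
    (sub-cong (λ { here → refl
                 ; (there x) → trans (sub-ren there (extS τ) (σ x)) (sym (ren-sub τ there (σ x))) }) t))
  sub-sub σ τ (app t u) = cong₂ app (sub-sub σ τ t) (sub-sub σ τ u)
  sub-sub σ τ (tc c) = refl
  sub-sub σ τ (con c) = refl

  sub-var : ∀ {Γ A} (t : Tm b C Γ A) → sub var t ≡ t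
  sub-var (var x) = refl
  sub-var (lam ok t) = cong (lam ok) (trans (sub-cong (λ { here → refl ; (there x) → refl }) t) (sub-var t))
  sub-var (app t u) = cong₂ app (sub-var t) (sub-var u)
  sub-var (tc c) = refl
  sub-var (con c) = refl

  sub-closed : ∀ {A} (σ : Sub {b} {C} [] []) (t : Tm b C [] A) → sub σ t ≡ t
  sub-closed σ t = trans (sub-cong (λ ()) t) (sub-var t)

  sub-wk0 : ∀ {Γ A} (σ : Sub {b} {C} Γ []) (t : Tm b C [] A) → sub σ (wk0 t) ≡ t
  sub-wk0 σ t = trans (sub-ren (λ ()) σ t) (sub-closed _ t)

  sub-extS-[] : ∀ {Γ A B} (σ : Sub {b} {C} Γ []) (t : Tm b C (B ∷ Γ) A) (u : Tm b C [] B) →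
                sub (extS σ) t [ u ] ≡ sub (consS u σ) t
  sub-extS-[] σ t u = trans (sub-sub (extS σ) (consS u var) t)
    (sub-cong (λ { here → refl
                 ; (there x) → trans (sub-ren there (consS u var) (σ x)) (sub-var (σ x)) }) t)

  extNums : ∀ {k Γ} → Sub {b} {C} Γ [] → Vec ℕ k → Sub {b} {C} (Nats k Γ) []
  extNums σ [] = σ
  extNums σ (n ∷ ns) = consS (num n) (extNums σ ns)

  sub-appN : ∀ k {Γ Δ A} (σ : Sub {b} {C} Γ Δ) (t : Tm b C Γ (nats k A)) as →
             sub σ (appN k t as) ≡ appN k (sub σ t) (Vec.map (sub σ) as)
  sub-appN zero σ t [] = refl
  sub-appN (suc k) σ t (a ∷ as) = cong (λ f → app f (sub σ a)) (sub-appN k σ t as)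

  sub-vars : ∀ k {Γ} (σ : Sub {b} {C} Γ []) (ns : Vec ℕ k) →
             Vec.map (sub (extNums σ ns)) (vars k) ≡ nums ns
  sub-vars zero σ [] = refl
  sub-vars (suc k) σ (n ∷ ns) = cong (num n ∷_) (begin
    Vec.map (sub (extNums σ (n ∷ ns))) (Vec.map (ren there) (vars k))
      ≡⟨ Vec.map-∘ _ _ (vars k) ⟨
    Vec.map (λ v → sub (extNums σ (n ∷ ns)) (ren there v)) (vars k)
      ≡⟨ Vec.map-cong (sub-ren there (extNums σ (n ∷ ns))) (vars k) ⟩
    Vec.map (sub (extNums σ ns)) (vars k)
      ≡⟨ sub-vars k σ ns ⟩
    nums ns ∎)
    where open ≡-Reasoning

  sub-appN-vars : ∀ k {Γ A} (σ : Sub {b} {C} Γ []) (h : Tm b C [] (nats k A)) (ns : Vec ℕ k) →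
                  sub (extNums σ ns) (appN k (wk0 h) (vars k)) ≡ appN k h (nums ns)
  sub-appN-vars k σ h ns = trans (sub-appN k (extNums σ ns) (wk0 h) (vars k))
    (cong₂ (appN k) (sub-wk0 (extNums σ ns) h) (sub-vars k σ ns))

  -- (λx⃗. t) n⃗, in the shape into which realizability of ∀x₁ … ∀x_k unfolds
  redex : ∀ k {A} → Tm b C (Nats k []) A → Vec ℕ k → Tm b C [] A
  redex zero t [] = t
  redex (suc k) t (n ∷ ns) = app (redex k (lam (okNat b) t) ns) (num n)

  appN-lamN : ∀ k {A} (t : Tm b C (Nats k []) A) (ns : Vec ℕ k) → appN k (lamN k t) (nums ns) ≡ redex k t ns
  appN-lamN zero t [] = refl
  appN-lamN (suc k) t (n ∷ ns) = cong (λ f → app f (num n)) (appN-lamN k (lam (okNat b) t) ns)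

  module Conversion (δ : ∀ {Γ A} → Tm b C Γ A → Tm b C Γ A → Set) where

    module ≈-Reasoning {Γ A} = SetoidReasoning (EqClosure.setoid (Step δ {Γ} {A}))

    step : ∀ {Γ A} {t u : Tm b C Γ A} → Step δ t u → Conv δ t u
    step = EqClosure.return

    ≡⇒conv : ∀ {Γ A} {t u : Tm b C Γ A} → t ≡ u → Conv δ t u
    ≡⇒conv refl = EqClosure.reflexive _

    conv-sym : ∀ {Γ A} {t u : Tm b C Γ A} → Conv δ t u → Conv δ u t
    conv-sym = EqClosure.symmetric _

    app-congˡ : ∀ {Γ A B} {t t′ : Tm b C Γ (A ⇒ B)} (u : Tm b C Γ A) → Conv δ t t′ → Conv δ (app t u) (app t′ u)
    app-congˡ u = EqClosure.gmap (λ t → app t u) ξappL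

    app-congʳ : ∀ {Γ A B} (t : Tm b C Γ (A ⇒ B)) {u u′ : Tm b C Γ A} → Conv δ u u′ → Conv δ (app t u) (app t u′)
    app-congʳ t = EqClosure.gmap (app t) ξappR

    appN-congˡ : ∀ k {Γ A} {t t′ : Tm b C Γ (nats k A)} as → Conv δ t t′ → Conv δ (appN k t as) (appN k t′ as)
    appN-congˡ zero [] c = c
    appN-congˡ (suc k) (a ∷ as) c = app-congˡ a (appN-congˡ k as c)

    redex-β : ∀ k {A} (t : Tm b C (Nats k []) A) (ns : Vec ℕ k) → Conv δ (redex k t ns) (sub (extNums emptySub ns) t)
    redex-β zero t [] = ≡⇒conv (sym (sub-closed _ t))
    redex-β (suc k) t (n ∷ ns) = begin
      app (redex k (lam (okNat b) t) ns) (num n)             ≈⟨ app-congˡ (num n) (redex-β k (lam (okNat b) t) ns) ⟩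
      app (lam (okNat b) (sub (extS (extNums emptySub ns)) t)) (num n) ≈⟨ step (β _ _) ⟩
      sub (extS (extNums emptySub ns)) t [ num n ]           ≡⟨ sub-extS-[] (extNums emptySub ns) t (num n) ⟩
      sub (extNums emptySub (n ∷ ns)) t                      ∎
      where open ≈-Reasoning

module T = Conversion {false} {NoC} noδ
module L = Conversion {true} {LearnC} δL

-- A set-theoretic model of T

⟦_⟧ : Ty → Set
⟦ nat ⟧ = ℕ
⟦ bool ⟧ = Bool
⟦ state ⟧ = ⊤
⟦ A ⊗ B ⟧ = ⟦ A ⟧ × ⟦ B ⟧
⟦ A ⇒ B ⟧ = ⟦ A ⟧ → ⟦ B ⟧

Env : Ctx → Set
Env Γ = ∀ {A} → Γ ∋ A → ⟦ A ⟧

_∷ᵉ_ : ∀ {Γ A} → ⟦ A ⟧ → Env Γ → Env (A ∷ Γ)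
(v ∷ᵉ γ) here = v
(v ∷ᵉ γ) (there x) = γ x

natrec : {X : Set} → X → (ℕ → X → X) → ℕ → X
natrec x f zero = x
natrec x f (suc n) = f n (natrec x f n)

evalC : ∀ {b A} → TConst b A → ⟦ A ⟧
evalC zeroC = zero
evalC sucC = suc
evalC trueC = true
evalC falseC = false
evalC (ifC _) = if_then_else_
evalC (recC _) = natrec
evalC (pairC _ _) = _,_
evalC (fstC _ _) = proj₁
evalC (sndC _ _) = proj₂

eval : ∀ {Γ A} → TTm Γ A → Env Γ → ⟦ A ⟧
eval (var x) γ = γ x
eval (lam _ t) γ = λ v → eval t (v ∷ᵉ γ)
eval (app t u) γ = eval t γ (eval u γ)
eval (tc c) γ = evalC c
eval (con ())

-- A partial equivalence relation standing in for function extensionality.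
Eq : ∀ A → ⟦ A ⟧ → ⟦ A ⟧ → Set
Eq nat x y = x ≡ y
Eq bool x y = x ≡ y
Eq state x y = ⊤
Eq (A ⊗ B) (x , x′) (y , y′) = Eq A x y × Eq B x′ y′
Eq (A ⇒ B) f g = ∀ x y → Eq A x y → Eq B (f x) (g y)

Eq-sym : ∀ A {x y} → Eq A x y → Eq A y x
Eq-sym nat e = sym e
Eq-sym bool e = sym e
Eq-sym state e = tt
Eq-sym (A ⊗ B) (e , e′) = Eq-sym A e , Eq-sym B e′
Eq-sym (A ⇒ B) e x y exy = Eq-sym B (e y x (Eq-sym A exy))

Eq-trans : ∀ A {x y z} → Eq A x y → Eq A y z → Eq A x z
Eq-trans nat e e′ = trans e e′
Eq-trans bool e e′ = trans e e′
Eq-trans state e e′ = tt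
Eq-trans (A ⊗ B) (e₁ , e₂) (e₁′ , e₂′) = Eq-trans A e₁ e₁′ , Eq-trans B e₂ e₂′
Eq-trans (A ⇒ B) e e′ x y exy = Eq-trans B (e x y exy) (e′ y y (Eq-trans A (Eq-sym A exy) exy))

Eq-reflˡ : ∀ A {x y} → Eq A x y → Eq A x x
Eq-reflˡ A e = Eq-trans A e (Eq-sym A e)

Eq-reflʳ : ∀ A {x y} → Eq A x y → Eq A y y
Eq-reflʳ A e = Eq-trans A (Eq-sym A e) e

EnvEq : ∀ {Γ} → Env Γ → Env Γ → Set
EnvEq {Γ} γ γ′ = ∀ {A} (x : Γ ∋ A) → Eq A (γ x) (γ′ x)

∷ᵉ-Eq : ∀ {Γ A} {v v′ : ⟦ A ⟧} {γ γ′ : Env Γ} → Eq A v v′ → EnvEq γ γ′ → EnvEq (v ∷ᵉ γ) (v′ ∷ᵉ γ′)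
∷ᵉ-Eq e E here = e
∷ᵉ-Eq e E (there x) = E x

natrec-Eq : ∀ A {x x′ f f′} → Eq A x x′ → Eq (nat ⇒ A ⇒ A) f f′ → ∀ n → Eq A (natrec x f n) (natrec x′ f′ n)
natrec-Eq A ex ef zero = ex
natrec-Eq A ex ef (suc n) = ef n n refl _ _ (natrec-Eq A ex ef n)

evalC-Eq : ∀ {A} (c : TConst false A) → Eq A (evalC c) (evalC c)
evalC-Eq zeroC = refl
evalC-Eq sucC x y e = cong suc e
evalC-Eq trueC = refl
evalC-Eq falseC = refl
evalC-Eq (ifC _) true .true refl x x′ ex y y′ ey = ex
evalC-Eq (ifC _) false .false refl x x′ ex y y′ ey = ey
evalC-Eq (recC {A} _) x x′ ex f f′ ef n .n refl = natrec-Eq A ex ef n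
evalC-Eq (pairC _ _) x x′ ex y y′ ey = ex , ey
evalC-Eq (fstC _ _) (x , y) (x′ , y′) (ex , ey) = ex
evalC-Eq (sndC _ _) (x , y) (x′ , y′) (ex , ey) = ey

eval-Eq : ∀ {Γ A} (t : TTm Γ A) {γ γ′ : Env Γ} → EnvEq γ γ′ → Eq A (eval t γ) (eval t γ′)
eval-Eq (var x) E = E x
eval-Eq (lam _ t) E v v′ e = eval-Eq t (∷ᵉ-Eq e E)
eval-Eq (app t u) E = eval-Eq t E _ _ (eval-Eq u E)
eval-Eq (tc c) E = evalC-Eq c
eval-Eq (con ())

eval-ren : ∀ {Γ Δ A} (ρ : Ren {false} {NoC} Γ Δ) (t : TTm Γ A) {γ γ′ : Env Δ} → EnvEq γ γ′ →
           Eq A (eval (ren ρ t) γ) (eval t (λ x → γ′ (ρ x)))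
eval-ren ρ (var x) E = E (ρ x)
eval-ren ρ (lam _ t) {γ} {γ′} E v v′ e = Eq-trans _ (eval-ren (extR ρ) t (∷ᵉ-Eq e E))
  (eval-Eq t (λ { here → Eq-reflʳ _ e ; (there x) → Eq-reflʳ _ (E (ρ x)) }))
eval-ren ρ (app t u) E = eval-ren ρ t E _ _ (eval-ren ρ u E)
eval-ren ρ (tc c) E = evalC-Eq c
eval-ren ρ (con ())

eval-sub : ∀ {Γ Δ A} (σ : Sub {false} {NoC} Γ Δ) (t : TTm Γ A) {γ γ′ : Env Δ} → EnvEq γ γ′ →
           Eq A (eval (sub σ t) γ) (eval t (λ x → eval (σ x) γ′))
eval-sub σ (var x) E = eval-Eq (σ x) E
eval-sub σ (lam _ t) E v v′ e = Eq-trans _ (eval-sub (extS σ) t (∷ᵉ-Eq e E))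
  (eval-Eq t (λ { here → Eq-reflʳ _ e
                ; (there x) → eval-ren there (σ x) (∷ᵉ-Eq (Eq-reflʳ _ e) (λ y → Eq-reflʳ _ (E y))) }))
eval-sub σ (app t u) E = eval-sub σ t E _ _ (eval-sub σ u E)
eval-sub σ (tc c) E = evalC-Eq c
eval-sub σ (con ())

eval-step : ∀ {Γ A} {t t′ : TTm Γ A} → t ⟶T t′ → {γ γ′ : Env Γ} → EnvEq γ γ′ → Eq A (eval t γ) (eval t′ γ′)
eval-step (β t u) E = Eq-trans _
  (eval-Eq t (λ { here → eval-Eq u (λ x → Eq-reflˡ _ (E x)) ; (there x) → Eq-reflˡ _ (E x) }))
  (Eq-sym _ (eval-sub (consS u var) t (λ x → Eq-sym _ (E x))))
eval-step (ifT x y) E = eval-Eq x E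
eval-step (ifF x y) E = eval-Eq y E
eval-step (recZ x f) E = eval-Eq x E
eval-step (recS {ok = ok} x f n) E = eval-Eq (app (app f n) (app (app (app (tc (recC ok)) x) f) n)) E
eval-step (fstR x y) E = eval-Eq x E
eval-step (sndR x y) E = eval-Eq y E
eval-step (delta ())
eval-step (ξlam s) E v v′ e = eval-step s (∷ᵉ-Eq e E)
eval-step (ξappL {u = u} s) E = eval-step s E _ _ (eval-Eq u E)
eval-step (ξappR {t = t} s) E = eval-Eq t E _ _ (eval-step s E)

eval-conv : ∀ {A} {t t′ : TTm [] A} → t ≅T t′ → Eq A (eval t (λ ())) (eval t′ (λ ()))
eval-conv {t = t} ε = eval-Eq t (λ ())
eval-conv (fwd s ◅ r) = Eq-trans _ (eval-step s (λ ())) (eval-conv r)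
eval-conv (bwd s ◅ r) = Eq-trans _ (Eq-sym _ (eval-step s (λ ()))) (eval-conv r)

true≇false : ¬ (tc {false} {NoC} {[]} trueC ≅T tc falseC)
true≇false c with eval-conv c
... | ()

-- Canonicity of closed boolean terms

Reducible : ∀ A → TTm [] A → Set
Reducible nat t = Σ ℕ λ n → t ≅T num n
Reducible bool t = t ≅T tc trueC ⊎ t ≅T tc falseC
Reducible state t = ⊤
Reducible (A ⊗ B) t = ∀ .(oa : Ok false A) .(ob : Ok false B) →
  Reducible A (app (tc (fstC oa ob)) t) × Reducible B (app (tc (sndC oa ob)) t)
Reducible (A ⇒ B) t = ∀ u → Reducible A u → Reducible B (app t u)

Reducible-expand : ∀ A {t t′} → t′ ≅T t → Reducible A t → Reducible A t′
Reducible-expand nat c (n , r) = n , c ◅◅ r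
Reducible-expand bool c (inj₁ r) = inj₁ (c ◅◅ r)
Reducible-expand bool c (inj₂ r) = inj₂ (c ◅◅ r)
Reducible-expand state c r = tt
Reducible-expand (A ⊗ B) c r oa ob =
  Reducible-expand A (T.app-congʳ _ c) (proj₁ (r oa ob)) , Reducible-expand B (T.app-congʳ _ c) (proj₂ (r oa ob))
Reducible-expand (A ⇒ B) c r u ru = Reducible-expand B (T.app-congˡ u c) (r u ru)

Reducible-rec : ∀ {A} .(o : Ok false A) {x f} → Reducible A x → Reducible (nat ⇒ A ⇒ A) f →
                ∀ m → Reducible A (app (app (app (tc (recC o)) x) f) (num m))
Reducible-rec {A} o {x} {f} rx rf zero = Reducible-expand A (T.step (recZ x f)) rx
Reducible-rec {A} o {x} {f} rx rf (suc m) =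
  Reducible-expand A (T.step (recS x f (num m))) (rf (num m) (m , ε) _ (Reducible-rec o rx rf m))

Reducible-const : ∀ {A} (c : TConst false A) → Reducible A (tc c)
Reducible-const zeroC = zero , ε
Reducible-const sucC u (n , r) = suc n , T.app-congʳ _ r
Reducible-const trueC = inj₁ ε
Reducible-const falseC = inj₂ ε
Reducible-const (ifC {A} _) c (inj₁ r) x rx y ry =
  Reducible-expand A (T.app-congˡ y (T.app-congˡ x (T.app-congʳ _ r)) ◅◅ T.step (ifT x y)) rx
Reducible-const (ifC {A} _) c (inj₂ r) x rx y ry =
  Reducible-expand A (T.app-congˡ y (T.app-congˡ x (T.app-congʳ _ r)) ◅◅ T.step (ifF x y)) ry
Reducible-const (recC {A} o) x rx f rf n (m , r) =
  Reducible-expand A (T.app-congʳ _ r) (Reducible-rec o rx rf m)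
Reducible-const (pairC {A} {B} _ _) x rx y ry oa ob =
  Reducible-expand A (T.step (fstR x y)) rx , Reducible-expand B (T.step (sndR x y)) ry
Reducible-const (fstC o o′) t rt = proj₁ (rt o o′)
Reducible-const (sndC o o′) t rt = proj₂ (rt o o′)

reducible : ∀ {Γ A} (t : TTm Γ A) (σ : Sub Γ []) → (∀ {B} (x : Γ ∋ B) → Reducible B (σ x)) →
            Reducible A (sub σ t)
reducible (var x) σ rσ = rσ x
reducible {A = A ⇒ B} (lam o t) σ rσ u ru =
  Reducible-expand B (T.step (β _ u) ◅◅ T.≡⇒conv (sub-extS-[] σ t u))
    (reducible t (consS u σ) λ { here → ru ; (there x) → rσ x })
reducible (app t u) σ rσ = reducible t σ rσ _ (reducible u σ rσ)
reducible (tc c) σ rσ = Reducible-const c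
reducible (con ()) σ rσ

bool-canonical : (t : TTm [] bool) → t ≅T tc trueC ⊎ t ≅T tc falseC
bool-canonical t = subst (Reducible bool) (sub-closed emptySub t) (reducible t emptySub (λ ()))

-- Decidable equality of keys

decTy : (A B : Ty) → Dec (A ≡ B)
decTy nat nat = yes refl
decTy nat bool = no λ ()
decTy nat state = no λ ()
decTy nat (_ ⊗ _) = no λ ()
decTy nat (_ ⇒ _) = no λ ()
decTy bool nat = no λ ()
decTy bool bool = yes refl
decTy bool state = no λ ()
decTy bool (_ ⊗ _) = no λ ()
decTy bool (_ ⇒ _) = no λ ()
decTy state nat = no λ ()
decTy state bool = no λ ()
decTy state state = yes refl
decTy state (_ ⊗ _) = no λ ()
decTy state (_ ⇒ _) = no λ ()
decTy (_ ⊗ _) nat = no λ ()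
decTy (_ ⊗ _) bool = no λ ()
decTy (_ ⊗ _) state = no λ ()
decTy (A ⊗ B) (A′ ⊗ B′) with decTy A A′ | decTy B B′
... | yes refl | yes refl = yes refl
... | no ne | _ = no λ { refl → ne refl }
... | _ | no ne = no λ { refl → ne refl }
decTy (_ ⊗ _) (_ ⇒ _) = no λ ()
decTy (_ ⇒ _) nat = no λ ()
decTy (_ ⇒ _) bool = no λ ()
decTy (_ ⇒ _) state = no λ ()
decTy (_ ⇒ _) (_ ⊗ _) = no λ ()
decTy (A ⇒ B) (A′ ⇒ B′) with decTy A A′ | decTy B B′
... | yes refl | yes refl = yes refl
... | no ne | _ = no λ { refl → ne refl }
... | _ | no ne = no λ { refl → ne refl }

dec∋ : ∀ {Γ A} (x y : Γ ∋ A) → Dec (x ≡ y)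
dec∋ here here = yes refl
dec∋ here (there y) = no λ ()
dec∋ (there x) here = no λ ()
dec∋ (there x) (there y) = Dec.map′ (cong there) (λ { refl → refl }) (dec∋ x y)

decTConst : ∀ {A} (c c′ : TConst false A) → Dec (c ≡ c′)
decTConst zeroC zeroC = yes refl
decTConst sucC sucC = yes refl
decTConst trueC trueC = yes refl
decTConst trueC falseC = no λ ()
decTConst falseC trueC = no λ ()
decTConst falseC falseC = yes refl
decTConst (ifC _) (ifC _) = yes refl
decTConst (recC _) (recC _) = yes refl
decTConst (pairC _ _) (pairC _ _) = yes refl
decTConst (fstC _ _) (fstC _ _) = yes refl
decTConst (fstC _ _) (sndC _ _) = no λ ()
decTConst (sndC _ _) (fstC _ _) = no λ ()
decTConst (sndC _ _) (sndC _ _) = yes refl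

decTTm : ∀ {Γ A} (t u : TTm Γ A) → Dec (t ≡ u)
decTTm (var x) (var y) = Dec.map′ (cong var) (λ { refl → refl }) (dec∋ x y)
decTTm (lam _ t) (lam _ u) = Dec.map′ (cong (lam _)) (λ { refl → refl }) (decTTm t u)
decTTm (app {A} t t′) (app {A′} u u′) with decTy A A′
... | no ne = no λ { refl → ne refl }
... | yes refl with decTTm t u | decTTm t′ u′
...   | yes refl | yes refl = yes refl
...   | no ne | _ = no λ { refl → ne refl }
...   | _ | no ne = no λ { refl → ne refl }
decTTm (tc c) (tc c′) = Dec.map′ (cong tc) (λ { refl → refl }) (decTConst c c′)
decTTm (var _) (lam _ _) = no λ ()
decTTm (var _) (app _ _) = no λ ()
decTTm (var _) (tc _) = no λ ()
decTTm (lam _ _) (var _) = no λ ()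
decTTm (lam _ _) (app _ _) = no λ ()
decTTm (lam _ _) (tc _) = no λ ()
decTTm (app _ _) (var _) = no λ ()
decTTm (app _ _) (lam _ _) = no λ ()
decTTm (app _ _) (tc _) = no λ ()
decTTm (tc _) (var _) = no λ ()
decTTm (tc _) (lam _ _) = no λ ()
decTTm (tc _) (app _ _) = no λ ()
decTTm (con ()) _
decTTm _ (con ())

decKey : (κ κ′ : Key) → Dec (κ ≡ κ′)
decKey = Product.≡-dec ℕ._≟_ (Product.≡-dec decTTm (Vec.≡-dec ℕ._≟_))

hasKey? : (s : State) (κ : Key) → Dec (HasKey s κ)
hasKey? s κ = Dec.map′ find (λ (a , a∈s , eq) → lose a∈s eq) (any? (λ a → decKey (key a) κ) (State.atoms s))

-- T inside T_Learn

embL : ∀ {Γ A} → TTm Γ A → LTm Γ A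
embL (var x) = var x
embL (lam _ t) = lam tt (embL t)
embL (app t u) = app (embL t) (embL u)
embL (tc c) = tc (embC c)
embL (con ())

embL-ren : ∀ {Γ Δ A} (ρ : Ren {false} {NoC} Γ Δ) (ρ′ : Ren {true} {LearnC} Γ Δ) →
           (∀ {B} (x : Γ ∋ B) → ρ x ≡ ρ′ x) → (t : TTm Γ A) → embL (ren ρ t) ≡ ren ρ′ (embL t)
embL-ren ρ ρ′ e (var x) = cong var (e x)
embL-ren ρ ρ′ e (lam _ t) =
  cong (lam tt) (embL-ren (extR ρ) (extR ρ′) (λ { here → refl ; (there x) → cong there (e x) }) t)
embL-ren ρ ρ′ e (app t u) = cong₂ app (embL-ren ρ ρ′ e t) (embL-ren ρ ρ′ e u)
embL-ren ρ ρ′ e (tc c) = refl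
embL-ren ρ ρ′ e (con ())

embL-sub : ∀ {Γ Δ A} (σ : Sub {false} {NoC} Γ Δ) (σ′ : Sub {true} {LearnC} Γ Δ) →
           (∀ {B} (x : Γ ∋ B) → embL (σ x) ≡ σ′ x) → (t : TTm Γ A) → embL (sub σ t) ≡ sub σ′ (embL t)
embL-sub σ σ′ e (var x) = e x
embL-sub σ σ′ e (lam _ t) = cong (lam tt) (embL-sub (extS σ) (extS σ′) e′ t)
  where
  e′ : ∀ {B} (x : _ ∋ B) → embL (extS σ x) ≡ extS σ′ x
  e′ here = refl
  e′ (there x) = trans (embL-ren there there (λ _ → refl) (σ x)) (cong (ren there) (e x))
embL-sub σ σ′ e (app t u) = cong₂ app (embL-sub σ σ′ e t) (embL-sub σ σ′ e u)
embL-sub σ σ′ e (tc c) = refl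
embL-sub σ σ′ e (con ())

embL-step : ∀ {Γ A} {t t′ : TTm Γ A} → t ⟶T t′ → Step δL (embL t) (embL t′)
embL-step (β t u) = subst (Step δL _)
  (sym (embL-sub (consS u var) (consS (embL u) var) (λ { here → refl ; (there x) → refl }) t))
  (β (embL t) (embL u))
embL-step (ifT x y) = ifT (embL x) (embL y)
embL-step (ifF x y) = ifF (embL x) (embL y)
embL-step (recZ x f) = recZ (embL x) (embL f)
embL-step (recS x f n) = recS (embL x) (embL f) (embL n)
embL-step (fstR x y) = fstR (embL x) (embL y)
embL-step (sndR x y) = sndR (embL x) (embL y)
embL-step (delta ())
embL-step (ξlam s) = ξlam (embL-step s)
embL-step (ξappL s) = ξappL (embL-step s)
embL-step (ξappR s) = ξappR (embL-step s)

embL-conv : ∀ {Γ A} {t t′ : TTm Γ A} → t ≅T t′ → embL t ≅L embL t′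
embL-conv = EqClosure.gmap embL embL-step

embL-num : ∀ {Γ} n → embL (num {false} {NoC} {Γ} n) ≡ num n
embL-num zero = refl
embL-num (suc n) = cong (app (tc sucC)) (embL-num n)

embL-appN-nums : ∀ k {Γ A} (t : TTm Γ (nats k A)) (ns : Vec ℕ k) →
                 embL (appN k t (nums ns)) ≡ appN k (embL t) (nums ns)
embL-appN-nums zero t [] = refl
embL-appN-nums (suc k) t (n ∷ ns) = cong₂ app (embL-appN-nums k t ns) (embL-num n)

module _ (s : State) where

  learn-tc : ∀ {Γ A} (c : TConst true A) → learn s (tc {Γ = Γ} c) ≡ tc c
  learn-tc zeroC = refl
  learn-tc sucC = refl
  learn-tc trueC = refl
  learn-tc falseC = refl
  learn-tc (ifC _) = refl
  learn-tc (recC _) = refl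
  learn-tc (pairC _ _) = refl
  learn-tc (fstC _ _) = refl
  learn-tc (sndC _ _) = refl

  learn-con-closed : ∀ {Γ Δ A} (ρ : Ren {true} {LearnC} Γ Δ) (c : ClassC A) → learn s (con c) ≡ ren ρ (learn s (con c))
  learn-con-closed ρ empty = refl
  learn-con-closed ρ (X P _) = refl
  learn-con-closed ρ (Φ P _) = refl
  learn-con-closed ρ (Add P _) = refl
  learn-con-closed ρ join = refl

  learn-ren : ∀ {Γ Δ A} (ρ : Ren {true} {ClassC} Γ Δ) (ρ′ : Ren {true} {LearnC} Γ Δ) →
              (∀ {B} (x : Γ ∋ B) → ρ x ≡ ρ′ x) → (t : CTm Γ A) → learn s (ren ρ t) ≡ ren ρ′ (learn s t)
  learn-ren ρ ρ′ e (var x) = cong var (e x)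
  learn-ren ρ ρ′ e (lam o t) =
    cong (lam o) (learn-ren (extR ρ) (extR ρ′) (λ { here → refl ; (there x) → cong there (e x) }) t)
  learn-ren ρ ρ′ e (app t u) = cong₂ app (learn-ren ρ ρ′ e t) (learn-ren ρ ρ′ e u)
  learn-ren ρ ρ′ e (tc c) = trans (learn-tc c) (cong (ren ρ′) (sym (learn-tc c)))
  learn-ren ρ ρ′ e (con c) = learn-con-closed ρ′ c

  learn-emb : ∀ {Γ A} (t : TTm Γ A) → learn s (emb t) ≡ embL t
  learn-emb (var x) = refl
  learn-emb (lam _ t) = cong (lam tt) (learn-emb t)
  learn-emb (app t u) = cong₂ app (learn-emb t) (learn-emb u)
  learn-emb (tc c) = learn-tc (embC c)
  learn-emb (con ())

  learn-num : ∀ {Γ} n → learn s (num {true} {ClassC} {Γ} n) ≡ num n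
  learn-num zero = refl
  learn-num (suc n) = cong (app (tc sucC)) (learn-num n)

  learn-appN : ∀ k {Γ A} (t : CTm Γ (nats k A)) as →
               learn s (appN k t as) ≡ appN k (learn s t) (Vec.map (learn s) as)
  learn-appN zero t [] = refl
  learn-appN (suc k) t (a ∷ as) = cong (λ f → app f (learn s a)) (learn-appN k t as)

  learn-appN-nums : ∀ k {Γ A} (t : CTm Γ (nats k A)) (ns : Vec ℕ k) →
                    learn s (appN k t (nums ns)) ≡ appN k (learn s t) (nums ns)
  learn-appN-nums zero t [] = refl
  learn-appN-nums (suc k) t (n ∷ ns) = cong₂ app (learn-appN-nums k t ns) (learn-num n)

  learn-vars : ∀ k {Γ} → Vec.map (learn s) (vars {true} {ClassC} k {Γ}) ≡ vars k
  learn-vars zero = refl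
  learn-vars (suc k) = cong (var here ∷_) (begin
    Vec.map (learn s) (Vec.map (ren there) (vars k))  ≡⟨ Vec.map-∘ _ _ (vars k) ⟨
    Vec.map (λ v → learn s (ren there v)) (vars k)    ≡⟨ Vec.map-cong (learn-ren there there (λ _ → refl)) (vars k) ⟩
    Vec.map (λ v → ren there (learn s v)) (vars k)    ≡⟨ Vec.map-∘ _ _ (vars k) ⟩
    Vec.map (ren there) (Vec.map (learn s) (vars k))  ≡⟨ cong (Vec.map (ren there)) (learn-vars k) ⟩
    Vec.map (ren there) (vars k)                      ∎)
    where open ≡-Reasoning

  learn-appN-vars : ∀ k {Γ A} (h : CTm [] (nats k A)) →
                    learn s (appN k (wk0 h) (vars k {Γ})) ≡ appN k (wk0 (learn s h)) (vars k)
  learn-appN-vars k h = trans (learn-appN k (wk0 h) (vars k))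
    (cong₂ (appN k) (learn-ren (λ ()) (λ ()) (λ ()) h) (learn-vars k))

  sub-learn-appN-vars : ∀ j {A} (h : CTm [] (nats j A)) (ms : Vec ℕ j) →
                        sub (extNums emptySub ms) (learn s (appN j (wk0 h) (vars j))) ≡ appN j (learn s h) (nums ms)
  sub-learn-appN-vars j h ms =
    trans (cong (sub (extNums emptySub ms)) (learn-appN-vars j h)) (sub-appN-vars j emptySub (learn s h) ms)

  learn-redex : ∀ k {A} (t : CTm (Nats k []) A) (ns : Vec ℕ k) → learn s (redex k t ns) ≡ redex k (learn s t) ns
  learn-redex zero t [] = refl
  learn-redex (suc k) t (n ∷ ns) = cong₂ app (learn-redex k (lam tt t) ns) (learn-num n)

  learn-atom : ∀ k (Q : TTm [] (nats k bool)) (ms : Vec ℕ k) →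
               learn s (sub (extNums noVars ms) (appN k (wk0 (emb Q)) (vars k))) ≡ embL (appN k Q (nums ms))
  learn-atom k Q ms = begin
    learn s (sub (extNums noVars ms) (appN k (wk0 (emb Q)) (vars k))) ≡⟨ cong (learn s) (sub-appN-vars k noVars (emb Q) ms) ⟩
    learn s (appN k (emb Q) (nums ms))                                ≡⟨ learn-appN-nums k (emb Q) ms ⟩
    appN k (learn s (emb Q)) (nums ms)                                ≡⟨ cong (λ t → appN k t (nums ms)) (learn-emb Q) ⟩
    appN k (embL Q) (nums ms)                                         ≡⟨ embL-appN-nums k Q ms ⟨
    embL (appN k Q (nums ms))                                         ∎
    where open ≡-Reasoning

  Real-allN : ∀ k {Γ} (A : Fm (Nats k Γ)) (σ : Sub Γ []) (t : CTm (Nats k []) ∣ A ∣) →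
              (∀ ns → Real s A (extNums σ ns) (redex k t ns)) → Real s (allN k A) σ (lamAll k A t)
  Real-allN zero A σ t r = r []
  Real-allN (suc k) A σ t r = Real-allN k (∀F A) σ (lam tt t) (λ ns n → r (n ∷ ns))

-- Realizing excluded middle

negT-true : ∀ {t : TTm [] bool} → t ≅T tc trueC → app negT t ≅T tc falseC
negT-true c = T.step (β _ _) ◅◅ T.app-congˡ _ (T.app-congˡ _ (T.app-congʳ _ c)) ◅◅ T.step (ifT _ _)

negT-false : ∀ {t : TTm [] bool} → t ≅T tc falseC → app negT t ≅T tc trueC
negT-false c = T.step (β _ _) ◅◅ T.app-congˡ _ (T.app-congˡ _ (T.app-congʳ _ c)) ◅◅ T.step (ifF _ _)

negP-nums : ∀ k (P : TTm [] (nats (suc k) bool)) (ms : Vec ℕ (suc k)) →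
            appN (suc k) (negP {k} P) (nums ms) ≅T app negT (appN (suc k) P (nums ms))
negP-nums k P ms = begin
  appN (suc k) (negP {k} P) (nums ms)              ≡⟨ appN-lamN (suc k) ¬P-body ms ⟩
  redex (suc k) ¬P-body ms                         ≈⟨ T.redex-β (suc k) ¬P-body ms ⟩
  app negT (sub (extNums emptySub ms) (appN (suc k) (wk0 P) (vars (suc k))))
                                                   ≡⟨ cong (app negT) (sub-appN-vars (suc k) emptySub P ms) ⟩
  app negT (appN (suc k) P (nums ms))              ∎
  where
  open T.≈-Reasoning
  ¬P-body : TTm (Nats (suc k) []) bool
  ¬P-body = app negT (appN (suc k) (wk0 P) (vars (suc k)))

-- The field holds is irrelevant; canonicity recovers it as a usable conversion.
atom-holds : (a : Atom) → appN (suc (Atom.k a)) (Atom.P a) (nums (Atom.m a ∷ Atom.ns a)) ≅T tc trueC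
atom-holds (mkAtom k P _ ns m holds) with bool-canonical (appN (suc k) P (nums (m ∷ ns)))
... | inj₁ P-true = P-true
... | inj₂ P-false = Irrelevant.⊥-elim (true≇false (T.conv-sym holds ◅◅ P-false))

pairL : ∀ {Γ A B} → LTm Γ A → LTm Γ B → LTm Γ (A ⊗ B)
pairL x y = app (app (tc (pairC tt tt)) x) y

E-body : ∀ k (P : TTm [] (nats (suc k) bool)) → .(Normal P) → CTm (Nats k []) ∣ EMbody k P ∣
E-body k P nf = pairT (appN k (con (X {k} P nf)) (vars k))
  (pairT (pairT (appN k (con (Φ {k} P nf)) (vars k)) (con empty))
         (lam tt (appN (suc k) (con (Add {k} P nf)) (vars (suc k)))))

module _ (s : State) (k : ℕ) (P : TTm [] (nats (suc k) bool)) (nf : Normal P) (ns : Vec ℕ k) where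

  realizer : CTm [] ∣ EMbody k P ∣
  realizer = redex k (E-body k P nf) ns

  χ̂ φ̂ : LTm [] _
  χ̂ = appN k (app (con (χ {k} P nf)) (con (st s))) (nums ns)
  φ̂ = appN k (app (con (φ {k} P nf)) (con (st s))) (nums ns)

  add̂ : ℕ → LTm [] state
  add̂ n = appN (suc k) (app (con (add {k} P nf)) (con (st s))) (nums (n ∷ ns))

  learnedAddBody : LTm (nat ∷ Nats k []) state
  learnedAddBody = learn s (appN (suc k) (con (Add {k} P nf)) (vars (suc k)))

  learnedAdd : LTm [] (nat ⇒ state)
  learnedAdd = lam tt (sub (extS (extNums emptySub ns)) learnedAddBody)

  learn-realizer : learn s realizer ≅L pairL χ̂ (pairL (pairL φ̂ (con (st emptyState))) learnedAdd)
  learn-realizer = begin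
    learn s realizer                                       ≡⟨ learn-redex s k (E-body k P nf) ns ⟩
    redex k (learn s (E-body k P nf)) ns                   ≈⟨ L.redex-β k _ ns ⟩
    sub (extNums emptySub ns) (learn s (E-body k P nf))    ≡⟨ cong₂ (λ x y → pairL x (pairL (pairL y (con (st emptyState))) learnedAdd))
                                                                    (sub-learn-appN-vars s k (con (X {k} P nf)) ns)
                                                                    (sub-learn-appN-vars s k (con (Φ {k} P nf)) ns) ⟩
    pairL χ̂ (pairL (pairL φ̂ (con (st emptyState))) learnedAdd) ∎
    where open L.≈-Reasoning

  learn-p₀ : learn s (app p₀ realizer) ≅L χ̂
  learn-p₀ = L.app-congʳ _ learn-realizer ◅◅ L.step (fstR _ _)

  learn-p₁ : learn s (app p₁ realizer) ≅L pairL φ̂ (con (st emptyState))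
  learn-p₁ = L.app-congʳ _ learn-realizer ◅◅ L.step (β _ _)
    ◅◅ L.app-congʳ _ (L.step (sndR _ _)) ◅◅ L.step (fstR _ _)

  learn-p₂ : learn s (app p₂ realizer) ≅L learnedAdd
  learn-p₂ = L.app-congʳ _ learn-realizer ◅◅ L.step (β _ _)
    ◅◅ L.app-congʳ _ (L.step (sndR _ _)) ◅◅ L.step (sndR _ _)

  learn-p₂-num : ∀ n → learn s (app (app p₂ realizer) (num n)) ≅L add̂ n
  learn-p₂-num n = begin
    learn s (app (app p₂ realizer) (num n))  ≈⟨ L.app-congˡ _ learn-p₂ ⟩
    app learnedAdd (learn s (num n))         ≡⟨ cong (app learnedAdd) (learn-num s n) ⟩
    app learnedAdd (num n)                   ≈⟨ L.step (β _ _) ⟩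
    _                                        ≡⟨ sub-extS-[] (extNums emptySub ns) learnedAddBody (num n) ⟩
    _                                        ≡⟨ sub-learn-appN-vars s (suc k) (con (Add {k} P nf)) (n ∷ ns) ⟩
    add̂ n                                    ∎
    where open L.≈-Reasoning

  negP-learned : ∀ n → ¬ HasKey s (k , P , ns) → learn s (app (app p₂ realizer) (num n)) ≅L con (st emptyState) →
                 embL (appN (suc k) (negP {k} P) (nums (n ∷ ns))) ≅L tc trueC
  negP-learned n no-key learned-nothing with bool-canonical (appN (suc k) P (nums (n ∷ ns)))
  ... | inj₂ P-false = embL-conv (negP-nums k P (n ∷ ns) ◅◅ negT-false P-false)
  ... | inj₁ P-true = embL-conv (negP-nums k P (n ∷ ns) ◅◅ negT-true P-true) ◅◅ L.conv-sym true≅false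
    where
    witness : Atom
    witness = mkAtom k P nf ns n P-true

    -- Add_P would have learned the witness, so the hypothesis identifies a nonempty state with ∅.
    singleton≅∅ : con (st (singleState witness)) ≅L con (st emptyState)
    singleton≅∅ = L.conv-sym (L.step (delta (add-new P nf s ns n no-key P-true)))
      ◅◅ L.conv-sym (learn-p₂-num n) ◅◅ learned-nothing

    true≅false : tc trueC ≅L tc falseC
    true≅false = L.conv-sym (L.step (delta (χ-yes P nf (singleState witness) ns (witness , here refl , refl))))
      ◅◅ L.appN-congˡ k (nums ns) (L.app-congʳ _ singleton≅∅)
      ◅◅ L.step (delta (χ-no P nf emptyState ns (λ { (_ , () , _) })))

  EMbody-realized : Real s (EMbody k P) (extNums noVars ns) realizer
  EMbody-realized with hasKey? s (k , P , ns)
  ... | yes (a , a∈s , a-key) =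
    inj₁ ( learn-p₀ ◅◅ L.step (delta (χ-yes P nf s ns (a , a∈s , a-key)))
         , Atom.m a
         , L.app-congʳ _ learn-p₁ ◅◅ L.step (fstR _ _) ◅◅ L.step (delta (φ-yes P nf s ns a a∈s a-key))
         , λ _ → L.≡⇒conv (learn-atom s (suc k) P (Atom.m a ∷ ns)) ◅◅ embL-conv P-holds )
    where
    P-holds : appN (suc k) P (nums (Atom.m a ∷ ns)) ≅T tc trueC
    P-holds = subst (λ (j , Q , ms) → appN (suc j) Q (nums (Atom.m a ∷ ms)) ≅T tc trueC) a-key (atom-holds a)
  ... | no no-key =
    inj₂ ( learn-p₀ ◅◅ L.step (delta (χ-no P nf s ns no-key))
         , λ n learned-nothing → L.≡⇒conv (learn-atom s (suc k) (negP {k} P) (n ∷ ns))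
                                 ◅◅ negP-learned n no-key learned-nothing )

mainTheorem2 : (k : ℕ) (P : TTm [] (nats (suc k) bool)) (nf : Normal P) →
    EM k P ⊩ E k P nf
mainTheorem2 k P nf s = Real-allN s k (EMbody k P) noVars (E-body k P nf) (EMbody-realized s k P nf)
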